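{- Consider the single-writer concurrent Euler Tour Tree structure described in the context, and two invocations of \texttt{find\_root} (possibly on different vertices, by reader threads), where the first returned $(r, v_1)$ and the second returned $(r, v_2)$ for the same node $r$. Suppose that some modification by the writer on the connected component containing $r$ started after the first \texttt{find\_root} invocation completed and finished before the moment at which the second \texttt{find\_root} invocation found its root (i.e. read \texttt{cur.parent} equal to \texttt{null} at $r$). Then $v_1 \neq v_2$.
   Context: Shared-memory model with asynchronous threads; single-word reads and writes are atomic. A forest is stored as a collection of nodes (the nodes of Cartesian trees representing Euler tours; each graph vertex has a node). Each node has a \texttt{parent} pointer (\texttt{null} iff the node is a root) and an integer field \texttt{version}. The parent-pointer graph is acyclic at all times (parent pointers always lead to nodes of higher random priority), and the connected components of the represented forest are the sets of nodes reaching the same root by parent pointers. Only one thread (the single writer) performs modifications (edge additions = tree merges, edge removals = tree splits), one at a time. Each modification, before doing anything else, increments the \texttt{version} of the root of each component it affects, and in particular of every node that is a root of an affected component before the modification or becomes such a root by it; during its physical restructuring the modification keeps the parent links so that the set of nodes reaching each root is unchanged, and the logical merge/split happens at a single write of one parent pointer (for a merge: setting the parent of the lower-priority root to a node of the other tree; for a split: nulling one parent pointer). Roots change only at that single write. Reader threads use \texttt{find\_root(u)}: starting with \texttt{cur := u}, repeatedly read \texttt{parent := cur.parent}; if it is \texttt{null} stop, else set \texttt{cur := parent}; finally return \texttt{(cur, cur.version)}, reading the version after finding the root. -}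

module Defs where

open import Data.Nat using (ℕ; suc; _≤_; _<_)
open import Data.Maybe using (Maybe; just; nothing)
open import Data.Product using (_×_; Σ)
open import Data.Sum using (_⊎_)
open import Relation.Nullary using (¬_)
open import Relation.Binary.PropositionalEquality using (_≡_; _≢_)
open import Function.Bundles using (_⇔_)

-- Shared memory.  A state assigns to every node its `parent` field
-- (nothing = null) and its `version` field.

record State (Node : Set) : Set where
  field
    parent  : Node → Maybe Node
    version : Node → ℕ
open State public

-- `Reaches s x z` : in state s, following parent pointers from x leads
-- to the root z (z has a null parent).  The connected component with
-- root z is the set of x with Reaches s x z.
data Reaches {Node : Set} (s : State Node) : Node → Node → Set where
  isRoot : ∀ {x} → parent s x ≡ nothing → Reaches s x x
  up     : ∀ {x y z} → parent s x ≡ just y → Reaches s y z → Reaches s x z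

IsRoot : {Node : Set} → State Node → Node → Set
IsRoot s x = parent s x ≡ nothing

-- Time is discrete: σ t is the memory state after t
-- atomic writes; a read "at time t" observes σ t and happens before
-- the write number t (which turns σ t into σ (suc t)).

Unchanged : {Node : Set} → State Node → State Node → Set
Unchanged s s' = (∀ x → parent s' x ≡ parent s x) × (∀ x → version s' x ≡ version s x)

data Step {Node : Set} (s s' : State Node) : Set where
  idle         : Unchanged s s' → Step s s'
  writeParent  : (y : Node) →
                 (∀ x → x ≢ y → parent s' x ≡ parent s x) →
                 (∀ x → version s' x ≡ version s x) → Step s s'
  incVersion   : (y : Node) → version s' y ≡ suc (version s y) →
                 (∀ x → x ≢ y → version s' x ≡ version s x) →
                 (∀ x → parent s' x ≡ parent s x) → Step s s'

-- One modification (edge addition = merge, edge removal = split) of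
-- the single writer.  Its writes are the steps t with start ≤ t < end:
--   * steps [start, incDone) : only version increments ("before doing
--     anything else"), after which every root of an affected component
--     and every node that becomes a root by it has been incremented;
--   * steps [incDone, write) : physical restructuring preserving, for
--     every root, the set of nodes reaching it;
--   * step  write            : the single logical parent write
--     (merge: parent of lower-priority root a := node y of the tree of b;
--      split: null one parent pointer);
--   * steps (write, end)     : restructuring preserving reach sets again.

module _ {Node : Set} (prio : Node → ℕ) (σ : ℕ → State Node) where

  data NeedsIncrement (Affected : Node → Set) (start end : ℕ) (x : Node) : Set where
    affectedRoot : Affected x → NeedsIncrement Affected start end x
    newRoot      : IsRoot (σ end) x → ¬ IsRoot (σ start) x → NeedsIncrement Affected start end x

  data LogicalWrite (Affected : Node → Set) (w : ℕ) : Set where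
    merge : (a b y : Node) → a ≢ b → prio a < prio b →
            IsRoot (σ w) a → Reaches (σ w) y b →
            parent (σ (suc w)) a ≡ just y →
            (∀ z → Affected z ⇔ ((z ≡ a) ⊎ (z ≡ b))) →
            LogicalWrite Affected w
    split : (x : Node) → ¬ IsRoot (σ w) x → IsRoot (σ (suc w)) x →
            (∀ z → Affected z ⇔ Reaches (σ w) x z) →
            LogicalWrite Affected w

  record Modification : Set₁ where
    field
      start incDone write end : ℕ
      start≤incDone : start ≤ incDone
      incDone≤write : incDone ≤ write
      write<end     : write < end
      Affected      : Node → Set
      affectedRoots : ∀ x → Affected x → IsRoot (σ start) x
      incPhaseParents : ∀ t x → start ≤ t → t < incDone →
                        parent (σ (suc t)) x ≡ parent (σ t) x
      increments    : ∀ x → NeedsIncrement Affected start end x →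
                      version (σ incDone) x ≡ suc (version (σ start) x)
      laterVersions : ∀ t x → incDone ≤ t → t < end →
                      version (σ (suc t)) x ≡ version (σ t) x
      beforeWrite   : ∀ t → incDone ≤ t → t ≤ write →
                      ∀ x z → Reaches (σ t) x z ⇔ Reaches (σ incDone) x z
      afterWrite    : ∀ t → suc write ≤ t → t ≤ end →
                      ∀ x z → Reaches (σ t) x z ⇔ Reaches (σ end) x z
      logical       : LogicalWrite Affected write

record Execution (Node : Set) : Set₁ where
  field
    prio    : Node → ℕ
    σ       : ℕ → State Node
    acyclic : ∀ t x y → parent (σ t) x ≡ just y → prio x < prio y
    steps   : ∀ t → Step (σ t) (σ (suc t))
    Mod     : Set
    mod     : Mod → Modification prio σ
    sequential : ∀ m m' → m ≢ m' →
                 Modification.end (mod m) ≤ Modification.start (mod m')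
                 ⊎ Modification.end (mod m') ≤ Modification.start (mod m)
    quiet   : ∀ t → (∀ m → ¬ (Modification.start (mod m) ≤ t × t < Modification.end (mod m))) →
              Unchanged (σ t) (σ (suc t))

-- Reader: find_root.  `Loop σ t u r tf` : the loop started with
-- cur := u, whose next read happens at a time ≥ t, terminates with
-- cur = r, reading r.parent = null at time tf.

data Loop {Node : Set} (σ : ℕ → State Node) : ℕ → Node → Node → ℕ → Set where
  stop : ∀ {t r tf} → t ≤ tf → parent (σ tf) r ≡ nothing → Loop σ t r r tf
  step : ∀ {t t' u p r tf} → t ≤ t' → parent (σ t') u ≡ just p →
         Loop σ t' p r tf → Loop σ t u r tf

record FindRoot {Node : Set} (σ : ℕ → State Node) (u r : Node) (ver : ℕ) : Set where
  field
    invoked found versionRead completed : ℕ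
    loop          : Loop σ invoked u r found
    found≤read    : found ≤ versionRead
    read≤complete : versionRead ≤ completed
    result        : version (σ versionRead) r ≡ ver

{-# OPTIONS --safe #-}
-- The version of a node never decreases, so it suffices that the version of r
-- strictly grows between the start of m and the moment F₂ finds r.  If r is a
-- root when m starts, r is the root of a component affected by m, which m
-- increments.  Otherwise r becomes a root at some time t before F₂ finds it;
-- a node can only become a root at the logical write of a modification m',
-- and m' increments the roots it creates before writing.  Since m' runs at
-- time t ≥ start of m, sequentiality puts the start of m' after the start of m.
module Submission where

open import Defs
open import Data.Nat using (ℕ; zero; suc; _≤_; _<_; _≤′_; ≤′-refl; ≤′-step; _≤?_; _<?_; z≤n; s≤s)
open import Data.Nat.Properties
open import Data.Maybe using (just; nothing)
open import Data.Product using (_×_; ∃; _,_; proj₁)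
open import Data.Sum using (inj₁; inj₂)
open import Data.Empty using (⊥-elim)
open import Relation.Nullary using (¬_; yes; no)
open import Relation.Nullary.Decidable using (decidable-stable)
open import Level using (0ℓ)
open import Relation.Unary using (Pred; Decidable)
open import Relation.Binary using (tri<; tri≈; tri>)
open import Relation.Binary.PropositionalEquality
open import Function.Base using (_∘_; case_of_)
open import Function.Bundles using (_⇔_; Equivalence)

last-switch : {P : Pred ℕ 0ℓ} → Decidable P → ∀ {a b} → a ≤ b → ¬ P a → P b →
              ∃ λ t → a ≤ t × t < b × ¬ P t × P (suc t)
last-switch P? {b = zero} z≤n ¬Pa Pb = ⊥-elim (¬Pa Pb)
last-switch P? {a} {suc b} a≤b+1 ¬Pa Pb+1 with m≤n⇒m<n∨m≡n a≤b+1
... | inj₂ refl = ⊥-elim (¬Pa Pb+1)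
... | inj₁ (s≤s a≤b) with P? b
...   | no ¬Pb = b , a≤b , n<1+n b , ¬Pb , Pb+1
...   | yes Pb with last-switch P? a≤b ¬Pa Pb
...     | t , a≤t , t<b , ¬Pt , Pt+1 = t , a≤t , m<n⇒m<1+n t<b , ¬Pt , Pt+1

isRoot? : {Node : Set} (s : State Node) → Decidable (IsRoot s)
isRoot? s x with parent s x
... | nothing = yes refl
... | just _  = no λ ()

root-reaches⇒≡ : {Node : Set} {s : State Node} {r R : Node} →
                 IsRoot s r → Reaches s r R → R ≡ r
root-reaches⇒≡ _  (isRoot _)   = refl
root-reaches⇒≡ rt (up r↑ _) with trans (sym rt) r↑
... | ()

loop-root : {Node : Set} {σ : ℕ → State Node} {t tf : ℕ} {u r : Node} →
            Loop σ t u r tf → IsRoot (σ tf) r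
loop-root (stop _ r-root) = r-root
loop-root (step _ _ rest) = loop-root rest

module _ {Node : Set} (E : Execution Node) where
  open Execution E

  reaches⇒prio-≤ : ∀ {t x z} → Reaches (σ t) x z → prio x ≤ prio z
  reaches⇒prio-≤ (isRoot _) = ≤-refl
  reaches⇒prio-≤ {t} (up x↑y rest) = ≤-trans (<⇒≤ (acyclic t _ _ x↑y)) (reaches⇒prio-≤ rest)

  reaches-self⇒root : ∀ {t r} → Reaches (σ t) r r → IsRoot (σ t) r
  reaches-self⇒root (isRoot r-root) = r-root
  reaches-self⇒root {t} (up r↑y rest) =
    ⊥-elim (<-irrefl refl (<-≤-trans (acyclic t _ _ r↑y) (reaches⇒prio-≤ rest)))

  root-transport : ∀ {t t' r} {A : Set} → Reaches (σ t) r r ⇔ A → Reaches (σ t') r r ⇔ A →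
                   IsRoot (σ t') r → IsRoot (σ t) r
  root-transport at-t at-t' r-root =
    reaches-self⇒root (Equivalence.from at-t (Equivalence.to at-t' (isRoot r-root)))

  version-step : ∀ t x → version (σ t) x ≤ version (σ (suc t)) x
  version-step t x with steps t
  ... | idle (_ , same)          = ≤-reflexive (sym (same x))
  ... | writeParent _ _ same     = ≤-reflexive (sym (same x))
  -- Node equality is not decidable, but the goal is, so x ≡ y may be split classically.
  ... | incVersion y inc other _ = decidable-stable (_ ≤? _) λ x≰ →
        x≰ (≤-reflexive (sym (other x λ { refl → x≰ (≤-trans (n≤1+n _) (≤-reflexive (sym inc))) })))

  version-mono′ : ∀ {t t'} x → t ≤′ t' → version (σ t) x ≤ version (σ t') x
  version-mono′ x ≤′-refl = ≤-refl
  version-mono′ x (≤′-step {n} t≤n) = ≤-trans (version-mono′ x t≤n) (version-step n x)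

  version-mono : ∀ {t t'} x → t ≤ t' → version (σ t) x ≤ version (σ t') x
  version-mono x t≤t' = version-mono′ x (≤⇒≤′ t≤t')

  module _ (M : Modification prio σ) where
    open Modification M

    incDone≤end : incDone ≤ end
    incDone≤end = ≤-trans incDone≤write (<⇒≤ write<end)

    start≤end : start ≤ end
    start≤end = ≤-trans start≤incDone incDone≤end

    incPhase-parent′ : ∀ {t} x → start ≤′ t → t ≤ incDone → parent (σ t) x ≡ parent (σ start) x
    incPhase-parent′ x ≤′-refl _ = refl
    incPhase-parent′ x (≤′-step {n} s≤n) n<i =
      trans (incPhaseParents n x (≤′⇒≤ s≤n) n<i) (incPhase-parent′ x s≤n (<⇒≤ n<i))

    root-at-start⇒root-at-write : ∀ {r} → IsRoot (σ start) r → IsRoot (σ write) r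
    root-at-start⇒root-at-write {r} r-root =
      reaches-self⇒root (Equivalence.from (beforeWrite write incDone≤write ≤-refl r r)
        (isRoot (trans (incPhase-parent′ r (≤⇒≤′ start≤incDone) ≤-refl) r-root)))

    root-after-write⇒root-at-end : ∀ {r} → IsRoot (σ (suc write)) r → IsRoot (σ end) r
    root-after-write⇒root-at-end {r} r-root =
      reaches-self⇒root (Equivalence.to (afterWrite (suc write) ≤-refl write<end r r) (isRoot r-root))

    becomes-root⇒write : ∀ {t r} → start ≤ t → t < end →
                         ¬ IsRoot (σ t) r → IsRoot (σ (suc t)) r → t ≡ write
    becomes-root⇒write {t} {r} s≤t t<e ¬root root′ with t <? incDone
    ... | yes t<i = ⊥-elim (¬root (trans (sym (incPhaseParents t r s≤t t<i)) root′))
    ... | no t≮i with ≮⇒≥ t≮i | <-cmp t write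
    ...   | i≤t | tri< t<w _ _ = ⊥-elim (¬root (root-transport
              (beforeWrite t i≤t (<⇒≤ t<w) r r) (beforeWrite (suc t) (m≤n⇒m≤1+n i≤t) t<w r r) root′))
    ...   | _   | tri≈ _ t≡w _ = t≡w
    ...   | _   | tri> _ _ w<t = ⊥-elim (¬root (root-transport
              (afterWrite t w<t (<⇒≤ t<e) r r) (afterWrite (suc t) (m≤n⇒m≤1+n w<t) t<e r r) root′))

    new-root-incremented : ∀ {r} → ¬ IsRoot (σ write) r → IsRoot (σ (suc write)) r →
                           version (σ incDone) r ≡ suc (version (σ start) r)
    new-root-incremented ¬root root′ = increments _
      (NeedsIncrement.newRoot (root-after-write⇒root-at-end root′) (¬root ∘ root-at-start⇒root-at-write))

  open Modification

  becomes-root⇒logical-write : ∀ {t r} → ¬ IsRoot (σ t) r → IsRoot (σ (suc t)) r →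
                               ¬ ¬ ∃ λ m → write (mod m) ≡ t
  becomes-root⇒logical-write {t} {r} ¬root root′ no-write =
    ¬root (trans (sym (proj₁ (quiet t no-running-modification) r)) root′)
    where
    no-running-modification : ∀ m → ¬ (start (mod m) ≤ t × t < end (mod m))
    no-running-modification m (s≤t , t<e) = no-write (m , sym (becomes-root⇒write (mod m) s≤t t<e ¬root root′))

  start≤start-of-running : ∀ {m m' t} → start (mod m) ≤ t → t < end (mod m') →
                           start (mod m) ≤ start (mod m')
  start≤start-of-running {m} {m'} s≤t t<e' = decidable-stable (_ ≤? _) λ s≰s' →
    (λ (m≢m' : m ≢ m') → case sequential m m' m≢m' of λ
      { (inj₁ e≤s') → s≰s' (≤-trans (start≤end (mod m)) e≤s')
      ; (inj₂ e'≤s) → ≤⇒≯ e'≤s (≤-<-trans s≤t t<e') })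
    (λ { refl → s≰s' ≤-refl })

  incremented⇒version-< : ∀ {a b r} m → a ≤ start (mod m) → incDone (mod m) ≤ b →
                          version (σ (incDone (mod m))) r ≡ suc (version (σ (start (mod m))) r) →
                          version (σ a) r < version (σ b) r
  incremented⇒version-< {a} {b} {r} m a≤s i≤b inc = begin-strict
    version (σ a) r                     ≤⟨ version-mono r a≤s ⟩
    version (σ (start (mod m))) r       <⟨ n<1+n _ ⟩
    suc (version (σ (start (mod m))) r) ≡⟨ sym inc ⟩
    version (σ (incDone (mod m))) r     ≤⟨ version-mono r i≤b ⟩
    version (σ b) r                     ∎
    where open ≤-Reasoning hiding (start)

  version-grows : ∀ {r f} m → IsRoot (σ f) r → end (mod m) ≤ f →
                  ∃ (λ R → Reaches (σ (start (mod m))) r R × Affected (mod m) R) →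
                  version (σ (start (mod m))) r < version (σ f) r
  version-grows {r} m root-f e≤f (R , r⇝R , affected) with isRoot? (σ (start (mod m))) r
  ... | yes root-s = incremented⇒version-< m ≤-refl (≤-trans (incDone≤end (mod m)) e≤f)
          (increments (mod m) r (NeedsIncrement.affectedRoot
            (subst (Affected (mod m)) (root-reaches⇒≡ root-s r⇝R) affected)))
  ... | no ¬root-s with last-switch (λ n → isRoot? (σ n) r) (≤-trans (start≤end (mod m)) e≤f) ¬root-s root-f
  ...   | t , s≤t , t<f , ¬root , root′ = decidable-stable (_ <? _) λ ≮ →
          becomes-root⇒logical-write ¬root root′ λ { (m' , refl) →
            ≮ (incremented⇒version-< m' (start≤start-of-running s≤t (write<end (mod m')))
                 (≤-trans (incDone≤write (mod m')) (<⇒≤ t<f))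
                 (new-root-incremented (mod m') ¬root root′)) }

lemma1 : {Node : Set} (E : Execution Node) (u₁ u₂ r : Node) (v₁ v₂ : ℕ)
    (F₁ : FindRoot (Execution.σ E) u₁ r v₁)
    (F₂ : FindRoot (Execution.σ E) u₂ r v₂)
    (m : Execution.Mod E) →
    FindRoot.completed F₁ ≤ Modification.start (Execution.mod E m) →
    Modification.end (Execution.mod E m) ≤ FindRoot.found F₂ →
    ∃ (λ R → Reaches (Execution.σ E (Modification.start (Execution.mod E m))) r R
    × Modification.Affected (Execution.mod E m) R) →
    v₁ ≢ v₂
lemma1 E u₁ u₂ r v₁ v₂ F₁ F₂ m c₁≤s e≤f₂ affected = <⇒≢ (begin-strict
  v₁                                   ≡⟨ sym (result F₁) ⟩
  version (σ (versionRead F₁)) r       ≤⟨ version-mono E r (≤-trans (read≤complete F₁) c₁≤s) ⟩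
  version (σ (start (mod m))) r        <⟨ version-grows E m (loop-root (loop F₂)) e≤f₂ affected ⟩
  version (σ (found F₂)) r             ≤⟨ version-mono E r (found≤read F₂) ⟩
  version (σ (versionRead F₂)) r       ≡⟨ result F₂ ⟩
  v₂                                   ∎)
  where
  open Execution E
  open Modification
  open FindRoot
  open ≤-Reasoning hiding (start)
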